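{- Let $(A,\rightarrow,\rightsquigarrow,1)$ be a pseudo BCK-algebra, $D$ a commutative deductive system of $A$ and $E$ a deductive system of $A$ with $D\subseteq E$. Then $E$ is a commutative deductive system of $A$.
   Context: A pseudo BCK-algebra is an algebra $(A,\rightarrow,\rightsquigarrow,1)$ of type $(2,2,0)$ such that for all $x,y,z\in A$: $(x\rightarrow y)\rightsquigarrow[(y\rightarrow z)\rightsquigarrow(x\rightarrow z)]=1$; $(x\rightsquigarrow y)\rightarrow[(y\rightsquigarrow z)\rightarrow(x\rightsquigarrow z)]=1$; $1\rightarrow x=x$; $1\rightsquigarrow x=x$; $x\rightarrow 1=1$; and if $x\rightarrow y=1$ and $y\rightarrow x=1$ then $x=y$. A deductive system of $A$ is a subset $D$ with $1\in D$ such that $x\in D$ and $x\rightarrow y\in D$ imply $y\in D$. It is commutative if for all $x,y$: $y\rightarrow x\in D$ implies $((x\rightarrow y)\rightsquigarrow y)\rightarrow x\in D$, and $y\rightsquigarrow x\in D$ implies $((x\rightsquigarrow y)\rightarrow y)\rightsquigarrow x\in D$. -}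

module Defs where

open import Level using (Level; suc; _⊔_)
open import Relation.Binary.PropositionalEquality using (_≡_)
open import Relation.Unary using (Pred; _∈_; _⊆_)

record PseudoBCK (a : Level) : Set (suc a) where
  infixr 5 _⇒_ _⇝_
  field
    Carrier : Set a
    _⇒_     : Carrier → Carrier → Carrier
    _⇝_     : Carrier → Carrier → Carrier
    𝟙       : Carrier
    ax1 : ∀ x y z → (x ⇒ y) ⇝ ((y ⇒ z) ⇝ (x ⇒ z)) ≡ 𝟙
    ax2 : ∀ x y z → (x ⇝ y) ⇒ ((y ⇝ z) ⇒ (x ⇝ z)) ≡ 𝟙
    ax3 : ∀ x → 𝟙 ⇒ x ≡ x
    ax4 : ∀ x → 𝟙 ⇝ x ≡ x
    ax5 : ∀ x → x ⇒ 𝟙 ≡ 𝟙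
    ax6 : ∀ x y → x ⇒ y ≡ 𝟙 → y ⇒ x ≡ 𝟙 → x ≡ y

module _ {a : Level} (A : PseudoBCK a) where
  open PseudoBCK A

  record IsDS {ℓ : Level} (D : Pred Carrier ℓ) : Set (a ⊔ ℓ) where
    field
      one∈ : 𝟙 ∈ D
      mp   : ∀ {x y} → x ∈ D → (x ⇒ y) ∈ D → y ∈ D

  record IsCommDS {ℓ : Level} (D : Pred Carrier ℓ) : Set (a ⊔ ℓ) where
    field
      isDS  : IsDS D
      comm⇒ : ∀ {x y} → (y ⇒ x) ∈ D → (((x ⇒ y) ⇝ y) ⇒ x) ∈ D
      comm⇝ : ∀ {x y} → (y ⇝ x) ∈ D → (((x ⇝ y) ⇒ y) ⇝ x) ∈ D

-- Let u = y → x ∈ E and t = u ⇝ x. Since y ≤ t, the element y → t = 1 lies in D, so commutativity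
-- of D yields ((t → y) ⇝ y) → t ∈ D ⊆ E. From x ≤ t and antitonicity in the first argument,
-- ((t → y) ⇝ y) → t ≤ ((x → y) ⇝ y) → (u ⇝ x) ≤ u ⇝ (((x → y) ⇝ y) → x), and modus ponens with
-- u ∈ E gives the →-half of commutativity for E. The ⇝-half is the →-half in the dual algebra,
-- obtained by swapping → and ⇝.
module Submission where

open import Defs
open import Level using (Level)
open import Relation.Unary using (Pred; _∈_; _⊆_)
open import Relation.Binary.PropositionalEquality using (_≡_; sym; trans; cong; cong₂; subst)

module PseudoBCK-Properties {a : Level} (A : PseudoBCK a) where
  open PseudoBCK A

  _≤_ : Carrier → Carrier → Set a
  x ≤ y = x ⇒ y ≡ 𝟙

  𝟙-mp⇒ : ∀ {p c} → p ≡ 𝟙 → p ⇒ c ≡ 𝟙 → c ≡ 𝟙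
  𝟙-mp⇒ {c = c} p≡𝟙 q = trans (sym (trans (cong (_⇒ c) p≡𝟙) (ax3 c))) q

  𝟙-mp⇝ : ∀ {p c} → p ≡ 𝟙 → p ⇝ c ≡ 𝟙 → c ≡ 𝟙
  𝟙-mp⇝ {c = c} p≡𝟙 q = trans (sym (trans (cong (_⇝ c) p≡𝟙) (ax4 c))) q

  x≤[x⇝y]⇒y : ∀ x y → x ≤ ((x ⇝ y) ⇒ y)
  x≤[x⇝y]⇒y x y = trans (cong₂ (λ u v → u ⇒ ((x ⇝ y) ⇒ v)) (sym (ax4 x)) (sym (ax4 y))) (ax2 𝟙 x y)

  x⇝[[x⇒y]⇝y]≡𝟙 : ∀ x y → x ⇝ ((x ⇒ y) ⇝ y) ≡ 𝟙
  x⇝[[x⇒y]⇝y]≡𝟙 x y = trans (cong₂ (λ u v → u ⇝ ((x ⇒ y) ⇝ v)) (sym (ax3 x)) (sym (ax3 y))) (ax1 𝟙 x y)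

  ≤⇒⇝≡𝟙 : ∀ {x y} → x ≤ y → x ⇝ y ≡ 𝟙
  ≤⇒⇝≡𝟙 {x} {y} x≤y = trans (cong (x ⇝_) (sym (trans (cong (_⇝ y) x≤y) (ax4 y)))) (x⇝[[x⇒y]⇝y]≡𝟙 x y)

  ⇝≡𝟙⇒≤ : ∀ {x y} → x ⇝ y ≡ 𝟙 → x ≤ y
  ⇝≡𝟙⇒≤ {x} {y} x⇝y≡𝟙 = trans (cong (x ⇒_) (sym (trans (cong (_⇒ y) x⇝y≡𝟙) (ax3 y)))) (x≤[x⇝y]⇒y x y)

  x⇝𝟙≡𝟙 : ∀ x → x ⇝ 𝟙 ≡ 𝟙
  x⇝𝟙≡𝟙 x = ≤⇒⇝≡𝟙 (ax5 x)

  ≤-trans : ∀ {x y z} → x ≤ y → y ≤ z → x ≤ z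
  ≤-trans {x} {y} {z} x≤y y≤z = 𝟙-mp⇝ y≤z (𝟙-mp⇝ x≤y (ax1 x y z))

  ⇒-antitoneˡ : ∀ {x y} z → x ≤ y → (y ⇒ z) ≤ (x ⇒ z)
  ⇒-antitoneˡ {x} {y} z x≤y = ⇝≡𝟙⇒≤ (𝟙-mp⇝ x≤y (ax1 x y z))

  ⇝-antitoneˡ : ∀ {x y} z → x ≤ y → (y ⇝ z) ≤ (x ⇝ z)
  ⇝-antitoneˡ {x} {y} z x≤y = 𝟙-mp⇒ (≤⇒⇝≡𝟙 x≤y) (ax2 x y z)

  x≤y⇝x : ∀ x y → x ≤ (y ⇝ x)
  x≤y⇝x x y = trans (cong (_⇒ (y ⇝ x)) (sym (ax4 x))) (𝟙-mp⇒ (x⇝𝟙≡𝟙 y) (ax2 y 𝟙 x))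

  ⇒⇝-exchange : ∀ x y z → (x ⇒ (y ⇝ z)) ≤ (y ⇝ (x ⇒ z))
  ⇒⇝-exchange x y z = ≤-trans (⇝≡𝟙⇒≤ (ax1 x (y ⇝ z) z)) (⇝-antitoneˡ (x ⇒ z) (x≤[x⇝y]⇒y y z))

  module DeductiveSystem {ℓ : Level} {E : Pred Carrier ℓ} (isDS : IsDS A E) where
    open IsDS isDS

    ∈-upward-closed : ∀ {x y} → x ∈ E → x ≤ y → y ∈ E
    ∈-upward-closed x∈E x≤y = mp x∈E (subst (_∈ E) (sym x≤y) one∈)

    mp⇝ : ∀ {x y} → x ∈ E → (x ⇝ y) ∈ E → y ∈ E
    mp⇝ {x} {y} x∈E x⇝y∈E = mp x⇝y∈E (∈-upward-closed x∈E (x≤[x⇝y]⇒y x y))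

dual : {a : Level} → PseudoBCK a → PseudoBCK a
dual A = record
  { Carrier = Carrier
  ; _⇒_ = _⇝_
  ; _⇝_ = _⇒_
  ; 𝟙 = 𝟙
  ; ax1 = ax2
  ; ax2 = ax1
  ; ax3 = ax4
  ; ax4 = ax3
  ; ax5 = x⇝𝟙≡𝟙
  ; ax6 = λ x y x⇝y≡𝟙 y⇝x≡𝟙 → ax6 x y (⇝≡𝟙⇒≤ x⇝y≡𝟙) (⇝≡𝟙⇒≤ y⇝x≡𝟙)
  }
  where
  open PseudoBCK A
  open PseudoBCK-Properties A

module _ {a ℓ : Level} {A : PseudoBCK a} {E : Pred (PseudoBCK.Carrier A) ℓ} where
  open PseudoBCK-Properties A using (module DeductiveSystem)

  IsDS-dual : IsDS A E → IsDS (dual A) E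
  IsDS-dual isDS = record { one∈ = one∈ ; mp = mp⇝ }
    where
    open IsDS isDS
    open DeductiveSystem isDS

  IsCommDS-dual : IsCommDS A E → IsCommDS (dual A) E
  IsCommDS-dual isCommDS = record { isDS = IsDS-dual isDS ; comm⇒ = comm⇝ ; comm⇝ = comm⇒ }
    where open IsCommDS isCommDS

comm⇒-upward : {a ℓ₁ ℓ₂ : Level} (A : PseudoBCK a)
  {D : Pred (PseudoBCK.Carrier A) ℓ₁} {E : Pred (PseudoBCK.Carrier A) ℓ₂} →
  IsCommDS A D → IsDS A E → D ⊆ E →
  let open PseudoBCK A in ∀ {x y} → (y ⇒ x) ∈ E → (((x ⇒ y) ⇝ y) ⇒ x) ∈ E
comm⇒-upward A {D} {E} isCommD isDSE D⊆E {x} {y} u∈E =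
  mp⇝ u∈E (∈-upward-closed w⇒t∈E (⇒⇝-exchange w u x))
  where
  open PseudoBCK A
  open PseudoBCK-Properties A
  open DeductiveSystem isDSE
  open IsCommDS isCommD using (isDS; comm⇒)
  u = y ⇒ x
  t = u ⇝ x
  w = (x ⇒ y) ⇝ y
  y⇒t∈D : (y ⇒ t) ∈ D
  y⇒t∈D = subst (_∈ D) (sym (⇝≡𝟙⇒≤ (x⇝[[x⇒y]⇝y]≡𝟙 y x))) (IsDS.one∈ isDS)
  w≤[t⇒y]⇝y : w ≤ ((t ⇒ y) ⇝ y)
  w≤[t⇒y]⇝y = ⇝-antitoneˡ y (⇒-antitoneˡ y (x≤y⇝x x u))
  w⇒t∈E : (w ⇒ t) ∈ E
  w⇒t∈E = ∈-upward-closed (D⊆E (comm⇒ y⇒t∈D)) (⇒-antitoneˡ t w≤[t⇒y]⇝y)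

proposition4p5 : {a ℓ₁ ℓ₂ : Level} (A : PseudoBCK a)
                 (D : Pred (PseudoBCK.Carrier A) ℓ₁) (E : Pred (PseudoBCK.Carrier A) ℓ₂) →
                 IsCommDS A D → IsDS A E → D ⊆ E → IsCommDS A E
proposition4p5 A D E isCommD isDSE D⊆E = record
  { isDS  = isDSE
  ; comm⇒ = comm⇒-upward A isCommD isDSE D⊆E
  ; comm⇝ = comm⇒-upward (dual A) (IsCommDS-dual isCommD) (IsDS-dual isDSE) D⊆E
  }
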